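{- Let $P$ be a finite pure poset which is strongly connected. Then either $P$ is an antichain, or for every $0 \leq i \leq \operatorname{rank}(P)-1$ the induced subposet of $P$ consisting of all elements of height $i$ and all elements of height $i+1$ is connected.
   Context: A chain of $P$ is a totally ordered subset; its length is its cardinality minus one. $\operatorname{rank}(P)$ is the maximum length of a chain of $P$; $P$ is pure if all maximal chains have the same length. The height of $p\in P$ is the rank of the induced subposet $\{q\in P: q\leq p\}$. An antichain is a poset in which any two distinct elements are incomparable. A poset is disconnected if it is the disjoint union (with no relations between the parts) of two nonempty induced subposets, and connected otherwise. A pure poset $P$ is strongly connected if for any two maximal chains $\gamma,\gamma'$ there is a sequence of maximal chains $\gamma=\sigma_0,\dots,\sigma_k=\gamma'$ such that $\sigma_j\cap\sigma_{j+1}$ is a chain of length $\operatorname{rank}(P)-1$ for all $0\le j\le k-1$. -}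

module Defs where

open import Level using (0ℓ)
open import Data.Nat using (ℕ; suc; _≤_)
open import Data.Fin using (Fin)
open import Data.Fin.Subset using (Subset; _∈_; _⊆_; _∩_; ∣_∣; Nonempty)
open import Data.Product using (Σ; _×_; ∃)
open import Data.Sum using (_⊎_)
open import Data.Empty using (⊥)
open import Relation.Nullary using (¬_)
open import Relation.Binary using (Rel)
open import Relation.Binary.PropositionalEquality using (_≡_)
open import Relation.Binary.Construct.Closure.ReflexiveTransitive using (Star)

module FinPoset {n : ℕ} (_≼_ : Rel (Fin n) 0ℓ) where

  IsChain : Subset n → Set
  IsChain S = ∀ x y → x ∈ S → y ∈ S → (x ≼ y) ⊎ (y ≼ x)

  -- RankWithin U r : the rank of the induced subposet on U is r, i.e. the
  -- maximum cardinality of a chain contained in U is r + 1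
  -- (so the maximum chain length, cardinality minus one, is r).
  RankWithin : (Fin n → Set) → ℕ → Set
  RankWithin U r =
    (Σ (Subset n) λ S → IsChain S × (∀ x → x ∈ S → U x) × ∣ S ∣ ≡ suc r)
    × (∀ S → IsChain S → (∀ x → x ∈ S → U x) → ∣ S ∣ ≤ suc r)

  IsRank : ℕ → Set
  IsRank r = RankWithin (λ _ → Fin n) r

  Height : Fin n → ℕ → Set
  Height p h = RankWithin (λ q → q ≼ p) h

  IsMaximalChain : Subset n → Set
  IsMaximalChain S = IsChain S × (∀ T → IsChain T → S ⊆ T → T ⊆ S)

  IsPure : Set
  IsPure = ∀ S T → IsMaximalChain S → IsMaximalChain T → ∣ S ∣ ≡ ∣ T ∣

  -- two maximal chains are adjacent if their intersection (automatically a
  -- chain) has length r - 1, i.e. cardinality r, where r = rank(P)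
  Adjacent : ℕ → Rel (Subset n) 0ℓ
  Adjacent r σ τ = IsMaximalChain σ × IsMaximalChain τ × ∣ σ ∩ τ ∣ ≡ r

  IsStronglyConnected : ℕ → Set
  IsStronglyConnected r =
    ∀ γ γ' → IsMaximalChain γ → IsMaximalChain γ' → Star (Adjacent r) γ γ'

  IsAntichain : Set
  IsAntichain = ∀ x y → x ≼ y → x ≡ y

  Disconnected : (Fin n → Set) → Set
  Disconnected U = Σ (Subset n) λ A → Σ (Subset n) λ B →
      (∀ x → U x → (x ∈ A ⊎ x ∈ B))
    × (∀ x → x ∈ A → U x)
    × (∀ x → x ∈ B → U x)
    × (∀ x → x ∈ A → x ∈ B → ⊥)
    × Nonempty A × Nonempty B
    × (∀ a b → a ∈ A → b ∈ B → ¬ (a ≼ b) × ¬ (b ≼ a))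

  Connected : (Fin n → Set) → Set
  Connected U = ¬ Disconnected U

  Layer : ℕ → Fin n → Set
  Layer i p = Height p i ⊎ Height p (suc i)

-- Suppose the layer of heights i and i + 1 (i < r) splits into parts A and B with no relations
-- between them. A maximal chain γ has r + 1 elements and is a longest chain, so its element with
-- exactly k elements of γ weakly below it has height k − 1. If γ meets A, every element of γ in the
-- layer is comparable to that element and hence lies in A; an adjacent chain γ' shares r of the
-- r + 1 elements of γ, among them one of height i or i + 1, so γ' meets A as well. By strong
-- connectivity a maximal chain through b ∈ B then meets A, which is impossible since b is
-- unrelated to A.
module Submission where

open import Defs
open import Level using (Level; 0ℓ)
open import Function using (id; _∘_; _on_)
open import Data.Nat using (ℕ; zero; suc; _+_; _≤_; _<_; z≤n; s≤s; _≟_; _≤?_)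
open import Data.Nat.Properties
open import Data.Fin using (Fin; zero; suc)
open import Data.Fin.Properties using (all?; any?)
open import Data.Fin.Subset
open import Data.Fin.Subset.Properties
open import Data.List using (List; []; _∷_; allFin)
open import Data.List.Membership.Propositional using () renaming (_∈_ to _∈ₗ_)
open import Data.List.Membership.Propositional.Properties using (∈-allFin)
open import Data.List.Relation.Unary.Any using (here; there)
open import Data.Vec using ([]; _∷_; here; there)
open import Data.Product using (∃; _×_; _,_; proj₁; proj₂)
open import Data.Sum as Sum using (_⊎_; inj₁; inj₂; [_,_]; swap)
open import Data.Empty using (⊥-elim)
open import Relation.Nullary using (¬_; Dec; yes; no; does)
open import Relation.Nullary.Decidable using (_×-dec_; ¬?; _⊎-dec_; _→-dec_)
open import Relation.Unary using (Pred; Decidable)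
open import Relation.Binary using (Rel; Reflexive; Transitive; IsDecPartialOrder)
open import Relation.Binary.PropositionalEquality using (_≡_; refl; sym; trans; cong; subst; subst₂)
open import Relation.Binary.Construct.Closure.ReflexiveTransitive using (Star; fold)

private
  variable
    ℓ : Level
    n : ℕ

subset : {P : Pred (Fin n) ℓ} → Decidable P → Subset n
subset {n = zero}  P? = []
subset {n = suc n} P? = does (P? zero) ∷ subset (P? ∘ suc)

∈-subset⁺ : {P : Pred (Fin n) ℓ} (P? : Decidable P) {x : Fin n} → P x → x ∈ subset P?
∈-subset⁺ P? {zero} px with P? zero
... | yes _  = here
... | no ¬px = ⊥-elim (¬px px)
∈-subset⁺ P? {suc x} px = there (∈-subset⁺ (P? ∘ suc) px)

∈-subset⁻ : {P : Pred (Fin n) ℓ} (P? : Decidable P) {x : Fin n} → x ∈ subset P? → P x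
∈-subset⁻ P? {zero} x∈ with P? zero | x∈
... | yes px | _ = px
∈-subset⁻ P? {suc x} (there x∈) = ∈-subset⁻ (P? ∘ suc) x∈

∣p∪q∣≡∣p∣+∣q∣ : (p q : Subset n) → (∀ {x} → x ∈ p → x ∉ q) → ∣ p ∪ q ∣ ≡ ∣ p ∣ + ∣ q ∣
∣p∪q∣≡∣p∣+∣q∣ []            []            _ = refl
∣p∪q∣≡∣p∣+∣q∣ (inside ∷ p)  (inside ∷ q)  disjoint = ⊥-elim (disjoint here here)
∣p∪q∣≡∣p∣+∣q∣ (inside ∷ p)  (outside ∷ q) disjoint =
  cong suc (∣p∪q∣≡∣p∣+∣q∣ p q λ x∈p x∈q → disjoint (there x∈p) (there x∈q))
∣p∪q∣≡∣p∣+∣q∣ (outside ∷ p) (inside ∷ q)  disjoint =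
  trans (cong suc (∣p∪q∣≡∣p∣+∣q∣ p q λ x∈p x∈q → disjoint (there x∈p) (there x∈q)))
        (sym (+-suc ∣ p ∣ ∣ q ∣))
∣p∪q∣≡∣p∣+∣q∣ (outside ∷ p) (outside ∷ q) disjoint =
  ∣p∪q∣≡∣p∣+∣q∣ p q λ x∈p x∈q → disjoint (there x∈p) (there x∈q)

∣p∪q∣≤∣p∣+∣q∣ : (p q : Subset n) → ∣ p ∪ q ∣ ≤ ∣ p ∣ + ∣ q ∣
∣p∪q∣≤∣p∣+∣q∣ []            []            = z≤n
∣p∪q∣≤∣p∣+∣q∣ (inside ∷ p)  (inside ∷ q)  =
  s≤s (≤-trans (∣p∪q∣≤∣p∣+∣q∣ p q) (≤-trans (n≤1+n _) (≤-reflexive (sym (+-suc ∣ p ∣ ∣ q ∣)))))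
∣p∪q∣≤∣p∣+∣q∣ (inside ∷ p)  (outside ∷ q) = s≤s (∣p∪q∣≤∣p∣+∣q∣ p q)
∣p∪q∣≤∣p∣+∣q∣ (outside ∷ p) (inside ∷ q)  =
  ≤-trans (s≤s (∣p∪q∣≤∣p∣+∣q∣ p q)) (≤-reflexive (sym (+-suc ∣ p ∣ ∣ q ∣)))
∣p∪q∣≤∣p∣+∣q∣ (outside ∷ p) (outside ∷ q) = ∣p∪q∣≤∣p∣+∣q∣ p q

greatest : (R : Rel (Fin n) ℓ) → Reflexive R → Transitive R → (S : Subset n) →
  (∀ {x y} → x ∈ S → y ∈ S → R x y ⊎ R y x) → Nonempty S →
  ∃ λ t → t ∈ S × (∀ {s} → s ∈ S → R s t)
greatest {n = suc n} R R-refl R-trans (s ∷ S) total nonempty with nonempty? S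
greatest R R-refl R-trans (inside ∷ S) total _ | no S-empty =
  zero , here , λ { here → R-refl ; (there s∈S) → ⊥-elim (S-empty (_ , s∈S)) }
greatest R R-refl R-trans (outside ∷ S) total (suc x , there x∈S) | no S-empty =
  ⊥-elim (S-empty (x , x∈S))
... | yes S-nonempty
  with greatest (R on suc) R-refl R-trans S (λ x∈ y∈ → total (there x∈) (there y∈)) S-nonempty
greatest R R-refl R-trans (outside ∷ S) total _ | yes _ | t , t∈S , ≤t =
  suc t , there t∈S , λ { (there s∈S) → ≤t s∈S }
greatest R R-refl R-trans (inside ∷ S) total _ | yes _ | t , t∈S , ≤t with total here (there t∈S)
... | inj₁ 0≤t = suc t , there t∈S , λ { here → 0≤t ; (there s∈S) → ≤t s∈S }
... | inj₂ t≤0 = zero , here , λ { here → R-refl ; (there s∈S) → R-trans (≤t s∈S) t≤0 }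

module DecPoset {_≼_ : Rel (Fin n) 0ℓ} (isDecPartialOrder : IsDecPartialOrder _≡_ _≼_) where
  open FinPoset _≼_
  open IsDecPartialOrder isDecPartialOrder
    renaming (refl to ≼-refl; trans to ≼-trans; antisym to ≼-antisym; _≤?_ to _≼?_)
    hiding (_≟_)

  ComparableToAll : Fin n → Subset n → Set
  ComparableToAll x T = ∀ {y} → y ∈ T → x ≼ y ⊎ y ≼ x

  comparableToAll? : ∀ x T → Dec (ComparableToAll x T)
  comparableToAll? x T with all? (λ y → (y ∈? T) →-dec ((x ≼? y) ⊎-dec (y ≼? x)))
  ... | yes all = yes λ {y} → all y
  ... | no ¬all = no λ all → ¬all λ y → all

  ⁅⁆-chain : ∀ x → IsChain ⁅ x ⁆
  ⁅⁆-chain x y z y∈ z∈ rewrite x∈⁅y⁆⇒x≡y x y∈ | x∈⁅y⁆⇒x≡y x z∈ = inj₁ ≼-refl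

  ∪⁅⁆-chain : ∀ {T x} → IsChain T → ComparableToAll x T → IsChain (T ∪ ⁅ x ⁆)
  ∪⁅⁆-chain {T} {x} T-chain x~T y z y∈ z∈ with x∈p∪q⁻ T ⁅ x ⁆ y∈ | x∈p∪q⁻ T ⁅ x ⁆ z∈
  ... | inj₁ y∈T | inj₁ z∈T = T-chain y z y∈T z∈T
  ... | inj₁ y∈T | inj₂ z∈x rewrite x∈⁅y⁆⇒x≡y x z∈x = swap (x~T y∈T)
  ... | inj₂ y∈x | inj₁ z∈T rewrite x∈⁅y⁆⇒x≡y x y∈x = x~T z∈T
  ... | inj₂ y∈x | inj₂ z∈x rewrite x∈⁅y⁆⇒x≡y x y∈x | x∈⁅y⁆⇒x≡y x z∈x = inj₁ ≼-refl

  insertIfComparable : ∀ x T → Dec (ComparableToAll x T) → Subset n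
  insertIfComparable x T (yes _) = T ∪ ⁅ x ⁆
  insertIfComparable x T (no _)  = T

  saturate : Subset n → List (Fin n) → Subset n
  saturate T []       = T
  saturate T (x ∷ xs) = saturate (insertIfComparable x T (comparableToAll? x T)) xs

  ⊆-saturate : ∀ T xs → T ⊆ saturate T xs
  ⊆-saturate T []       = λ x∈ → x∈
  ⊆-saturate T (x ∷ xs) with comparableToAll? x T
  ... | yes _ = ⊆-saturate (T ∪ ⁅ x ⁆) xs ∘ p⊆p∪q ⁅ x ⁆
  ... | no _  = ⊆-saturate T xs

  saturate-chain : ∀ {T} xs → IsChain T → IsChain (saturate T xs)
  saturate-chain []       T-chain = T-chain
  saturate-chain {T} (x ∷ xs) T-chain with comparableToAll? x T
  ... | yes x~T = saturate-chain xs (∪⁅⁆-chain T-chain x~T)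
  ... | no _    = saturate-chain xs T-chain

  saturate-complete : ∀ T xs {y} → y ∈ₗ xs → ComparableToAll y (saturate T xs) → y ∈ saturate T xs
  saturate-complete T (x ∷ xs) (there y∈xs) y~ = saturate-complete _ xs y∈xs y~
  saturate-complete T (x ∷ xs) (here refl) y~ with comparableToAll? x T
  ... | yes _   = ⊆-saturate (T ∪ ⁅ x ⁆) xs (q⊆p∪q T ⁅ x ⁆ (x∈⁅x⁆ x))
  ... | no ¬x~T = ⊥-elim (¬x~T (y~ ∘ ⊆-saturate T xs))

  extend : Subset n → Subset n
  extend T = saturate T (allFin n)

  ⊆-extend : ∀ T → T ⊆ extend T
  ⊆-extend T = ⊆-saturate T (allFin n)

  extend-maximal : ∀ {T} → IsChain T → IsMaximalChain (extend T)
  extend-maximal {T} T-chain = saturate-chain (allFin n) T-chain , λ U U-chain ext⊆U {y} y∈U →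
    saturate-complete T (allFin n) (∈-allFin y) λ {z} z∈ → U-chain y z y∈U (ext⊆U z∈)

  chain-⊆ : ∀ {S T} → IsChain T → S ⊆ T → IsChain S
  chain-⊆ T-chain S⊆T x y x∈ y∈ = T-chain x y (S⊆T x∈) (S⊆T y∈)

  _↓_ : Subset n → Fin n → Subset n
  γ ↓ z = subset λ x → (x ∈? γ) ×-dec (x ≼? z)

  -- When γ is a chain containing z, these are the elements of γ strictly above z.
  _↑_ : Subset n → Fin n → Subset n
  γ ↑ z = subset λ x → (x ∈? γ) ×-dec ¬? (x ≼? z)

  ∣γ↓z∣+∣γ↑z∣≡∣γ∣ : ∀ γ z → ∣ γ ↓ z ∣ + ∣ γ ↑ z ∣ ≡ ∣ γ ∣
  ∣γ↓z∣+∣γ↑z∣≡∣γ∣ γ z = trans (sym (∣p∪q∣≡∣p∣+∣q∣ (γ ↓ z) (γ ↑ z) disjoint)) (cong ∣_∣ (⊆-antisym ∪⊆γ γ⊆∪))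
    where
    disjoint : ∀ {x} → x ∈ γ ↓ z → x ∉ γ ↑ z
    disjoint x∈↓ x∈↑ = proj₂ (∈-subset⁻ _ x∈↑) (proj₂ (∈-subset⁻ _ x∈↓))
    ∪⊆γ : γ ↓ z ∪ γ ↑ z ⊆ γ
    ∪⊆γ x∈ with x∈p∪q⁻ (γ ↓ z) (γ ↑ z) x∈
    ... | inj₁ x∈↓ = proj₁ (∈-subset⁻ _ x∈↓)
    ... | inj₂ x∈↑ = proj₁ (∈-subset⁻ _ x∈↑)
    γ⊆∪ : γ ⊆ γ ↓ z ∪ γ ↑ z
    γ⊆∪ {x} x∈γ with x ≼? z
    ... | yes x≼z = x∈p∪q⁺ (inj₁ (∈-subset⁺ _ (x∈γ , x≼z)))
    ... | no  x⋠z = x∈p∪q⁺ (inj₂ (∈-subset⁺ _ (x∈γ , x⋠z)))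

  ↑-above : ∀ {γ z x} → IsChain γ → z ∈ γ → x ∈ γ ↑ z → z ≼ x
  ↑-above {γ} {z} {x} γ-chain z∈γ x∈↑ with ∈-subset⁻ _ x∈↑
  ... | x∈γ , x⋠z = [ ⊥-elim ∘ x⋠z , id ] (γ-chain x z x∈γ z∈γ)

  Empty⇒∣p∣≡0 : ∀ {p : Subset n} → Empty p → ∣ p ∣ ≡ 0
  Empty⇒∣p∣≡0 p-empty = trans (cong ∣_∣ (Empty-unique p-empty)) (∣⊥∣≡0 n)

  shallow-card≤ : ∀ {γ L k} → IsChain γ → L ⊆ γ → (∀ {x} → x ∈ L → ∣ γ ↓ x ∣ ≤ k) → ∣ L ∣ ≤ k
  shallow-card≤ {γ} {L} {k} γ-chain L⊆γ shallow with nonempty? L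
  ... | no L-empty = subst (_≤ k) (sym (Empty⇒∣p∣≡0 L-empty)) z≤n
  ... | yes L-nonempty with greatest _≼_ ≼-refl ≼-trans L (chain-⊆ γ-chain L⊆γ _ _) L-nonempty
  ... | t , t∈L , ≼t = ≤-trans (p⊆q⇒∣p∣≤∣q∣ L⊆γ↓t) (shallow t∈L)
    where
    L⊆γ↓t : L ⊆ γ ↓ t
    L⊆γ↓t s∈L = ∈-subset⁺ _ (L⊆γ s∈L , ≼t s∈L)

  deep-card≤ : ∀ {γ H k} → IsChain γ → H ⊆ γ → (∀ {x} → x ∈ H → k ≤ ∣ γ ↓ x ∣) → k ≤ suc ∣ γ ∣ →
    ∣ H ∣ + k ≤ suc ∣ γ ∣
  deep-card≤ {γ} {H} {k} γ-chain H⊆γ deep k≤ with nonempty? H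
  ... | no H-empty = subst (λ h → h + k ≤ suc ∣ γ ∣) (sym (Empty⇒∣p∣≡0 H-empty)) k≤
  ... | yes H-nonempty
    with greatest (λ x y → y ≼ x) ≼-refl (λ x≽y y≽z → ≼-trans y≽z x≽y) H
                  (λ x∈ y∈ → chain-⊆ γ-chain H⊆γ _ _ y∈ x∈) H-nonempty
  ... | b , b∈H , b≼ = begin
    ∣ H ∣ + k                   ≤⟨ +-mono-≤ ∣H∣≤ (deep b∈H) ⟩
    suc ∣ γ ↑ b ∣ + ∣ γ ↓ b ∣   ≡⟨ cong suc (+-comm ∣ γ ↑ b ∣ ∣ γ ↓ b ∣) ⟩
    suc (∣ γ ↓ b ∣ + ∣ γ ↑ b ∣) ≡⟨ cong suc (∣γ↓z∣+∣γ↑z∣≡∣γ∣ γ b) ⟩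
    suc ∣ γ ∣                   ∎
    where
    open ≤-Reasoning
    H⊆ : H ⊆ ⁅ b ⁆ ∪ γ ↑ b
    H⊆ {s} s∈H with s ≼? b
    ... | yes s≼b = x∈p∪q⁺ (inj₁ (subst (_∈ ⁅ b ⁆) (≼-antisym (b≼ s∈H) s≼b) (x∈⁅x⁆ b)))
    ... | no  s⋠b = x∈p∪q⁺ (inj₂ (∈-subset⁺ _ (H⊆γ s∈H , s⋠b)))
    ∣H∣≤ : ∣ H ∣ ≤ suc ∣ γ ↑ b ∣
    ∣H∣≤ = ≤-trans (p⊆q⇒∣p∣≤∣q∣ H⊆)
      (≤-trans (∣p∪q∣≤∣p∣+∣q∣ ⁅ b ⁆ (γ ↑ b)) (≤-reflexive (cong (_+ ∣ γ ↑ b ∣) (∣⁅x⁆∣≡1 b))))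

  -- With depth x = ∣ γ ↓ x ∣: the elements of C of depth at most i, resp. at least i + 3, number
  -- at most i, resp. m − i − 1, so they cannot exhaust the m elements of C.
  depth-in-layer : ∀ {γ C m} i → IsChain γ → ∣ γ ∣ ≡ suc m → C ⊆ γ → ∣ C ∣ ≡ m → suc i ≤ m →
    ∃ λ z → z ∈ C × (∣ γ ↓ z ∣ ≡ suc i ⊎ ∣ γ ↓ z ∣ ≡ suc (suc i))
  depth-in-layer {γ} {C} {m} i γ-chain ∣γ∣≡ C⊆γ ∣C∣≡ i<m
    with any? (λ z → (z ∈? C) ×-dec ((∣ γ ↓ z ∣ ≟ suc i) ⊎-dec (∣ γ ↓ z ∣ ≟ suc (suc i))))
  ... | yes hit = hit
  ... | no miss = ⊥-elim (<⇒≱ ∣Deep∣<m m≤∣Deep∣)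
    where
    Shallow Deep : Subset n
    Shallow = subset λ x → (x ∈? C) ×-dec (∣ γ ↓ x ∣ ≤? i)
    Deep    = subset λ x → (x ∈? C) ×-dec (suc (suc (suc i)) ≤? ∣ γ ↓ x ∣)

    C⊆ : C ⊆ Shallow ∪ Deep
    C⊆ {x} x∈C with ∣ γ ↓ x ∣ ≤? i
    ... | yes shallow = x∈p∪q⁺ (inj₁ (∈-subset⁺ _ (x∈C , shallow)))
    ... | no ¬shallow = x∈p∪q⁺ (inj₂ (∈-subset⁺ _ (x∈C , deep)))
      where
      deep : suc (suc (suc i)) ≤ ∣ γ ↓ x ∣
      deep = ≤∧≢⇒< (≤∧≢⇒< (≰⇒> ¬shallow) λ eq → miss (x , x∈C , inj₁ (sym eq)))
                   λ eq → miss (x , x∈C , inj₂ (sym eq))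

    ∣Shallow∣≤ : ∣ Shallow ∣ ≤ i
    ∣Shallow∣≤ = shallow-card≤ γ-chain (C⊆γ ∘ proj₁ ∘ ∈-subset⁻ _) (proj₂ ∘ ∈-subset⁻ _)

    ∣Deep∣+ : suc (suc (suc (i + ∣ Deep ∣))) ≤ suc (suc m)
    ∣Deep∣+ = subst₂ _≤_ (+-comm ∣ Deep ∣ (suc (suc (suc i)))) (cong suc ∣γ∣≡)
      (deep-card≤ γ-chain (C⊆γ ∘ proj₁ ∘ ∈-subset⁻ _) (proj₂ ∘ ∈-subset⁻ _)
        (subst (suc (suc (suc i)) ≤_) (cong suc (sym ∣γ∣≡)) (s≤s (s≤s i<m))))

    ∣Deep∣<m : i + ∣ Deep ∣ < m
    ∣Deep∣<m = ≤-pred (≤-pred ∣Deep∣+)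

    m≤∣Deep∣ : m ≤ i + ∣ Deep ∣
    m≤∣Deep∣ = begin
      m                         ≡⟨ sym ∣C∣≡ ⟩
      ∣ C ∣                     ≤⟨ p⊆q⇒∣p∣≤∣q∣ C⊆ ⟩
      ∣ Shallow ∪ Deep ∣        ≤⟨ ∣p∪q∣≤∣p∣+∣q∣ Shallow Deep ⟩
      ∣ Shallow ∣ + ∣ Deep ∣    ≤⟨ +-monoˡ-≤ ∣ Deep ∣ ∣Shallow∣≤ ⟩
      i + ∣ Deep ∣              ∎
      where open ≤-Reasoning

  -- The chain γ ↓ z is as long as possible below z: a longer chain below z could be completed by γ ↑ z
  -- to a chain longer than γ.
  longest-chain-height : ∀ {γ z h} → IsChain γ → (∀ S → IsChain S → ∣ S ∣ ≤ ∣ γ ∣) →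
    z ∈ γ → ∣ γ ↓ z ∣ ≡ suc h → Height z h
  longest-chain-height {γ} {z} {h} γ-chain longest z∈γ ∣γ↓z∣≡ =
    (γ ↓ z , chain-⊆ γ-chain (proj₁ ∘ ∈-subset⁻ _) , (λ _ → proj₂ ∘ ∈-subset⁻ _) , ∣γ↓z∣≡) , bound
    where
    bound : ∀ C → IsChain C → (∀ x → x ∈ C → x ≼ z) → ∣ C ∣ ≤ suc h
    bound C C-chain C≼z = subst (∣ C ∣ ≤_) ∣γ↓z∣≡ (+-cancelʳ-≤ ∣ γ ↑ z ∣ ∣ C ∣ ∣ γ ↓ z ∣ (begin
      ∣ C ∣ + ∣ γ ↑ z ∣           ≡⟨ sym (∣p∪q∣≡∣p∣+∣q∣ C (γ ↑ z) disjoint) ⟩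
      ∣ C ∪ γ ↑ z ∣               ≤⟨ longest (C ∪ γ ↑ z) C∪↑-chain ⟩
      ∣ γ ∣                       ≡⟨ sym (∣γ↓z∣+∣γ↑z∣≡∣γ∣ γ z) ⟩
      ∣ γ ↓ z ∣ + ∣ γ ↑ z ∣       ∎))
      where
      open ≤-Reasoning
      disjoint : ∀ {x} → x ∈ C → x ∉ γ ↑ z
      disjoint x∈C x∈↑ = proj₂ (∈-subset⁻ _ x∈↑) (C≼z _ x∈C)
      C∪↑-chain : IsChain (C ∪ γ ↑ z)
      C∪↑-chain x y x∈ y∈ with x∈p∪q⁻ C (γ ↑ z) x∈ | x∈p∪q⁻ C (γ ↑ z) y∈
      ... | inj₁ x∈C | inj₁ y∈C = C-chain x y x∈C y∈C
      ... | inj₁ x∈C | inj₂ y∈↑ = inj₁ (≼-trans (C≼z x x∈C) (↑-above γ-chain z∈γ y∈↑))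
      ... | inj₂ x∈↑ | inj₁ y∈C = inj₂ (≼-trans (C≼z y y∈C) (↑-above γ-chain z∈γ x∈↑))
      ... | inj₂ x∈↑ | inj₂ y∈↑ = γ-chain x y (proj₁ (∈-subset⁻ _ x∈↑)) (proj₁ (∈-subset⁻ _ y∈↑))

  module Pure {r} (rank : IsRank r) (pure : IsPure) where

    chain-size≤ : ∀ S → IsChain S → ∣ S ∣ ≤ suc r
    chain-size≤ S S-chain = proj₂ rank S S-chain λ x _ → x

    maximalChain-size : ∀ {γ} → IsMaximalChain γ → ∣ γ ∣ ≡ suc r
    maximalChain-size γ-maximal with proj₁ rank
    ... | S , S-chain , _ , ∣S∣≡ = trans (pure _ _ γ-maximal S⁺-maximal)
      (≤-antisym (chain-size≤ _ (proj₁ S⁺-maximal))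
                 (subst (_≤ ∣ extend S ∣) ∣S∣≡ (p⊆q⇒∣p∣≤∣q∣ (⊆-extend S))))
      where
      S⁺-maximal : IsMaximalChain (extend S)
      S⁺-maximal = extend-maximal S-chain

    maximalChain-layer : ∀ {γ z i} → IsMaximalChain γ → z ∈ γ →
      ∣ γ ↓ z ∣ ≡ suc i ⊎ ∣ γ ↓ z ∣ ≡ suc (suc i) → Layer i z
    maximalChain-layer {γ} {z} γ-maximal z∈γ = Sum.map height height
      where
      longest : ∀ S → IsChain S → ∣ S ∣ ≤ ∣ γ ∣
      longest S S-chain = subst (∣ S ∣ ≤_) (sym (maximalChain-size γ-maximal)) (chain-size≤ S S-chain)
      height : ∀ {h} → ∣ γ ↓ z ∣ ≡ suc h → Height z h
      height = longest-chain-height (proj₁ γ-maximal) longest z∈γ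

    module _ {i A B} (i<r : suc i ≤ r) (cover : ∀ x → Layer i x → x ∈ A ⊎ x ∈ B)
             (unrelated : ∀ a b → a ∈ A → b ∈ B → ¬ (a ≼ b) × ¬ (b ≼ a)) where

      MeetsA : Subset n → Set
      MeetsA γ = ∃ λ x → x ∈ γ × x ∈ A

      chain-meetingA-avoidsB : ∀ {γ z} → IsChain γ → MeetsA γ → z ∈ γ → z ∉ B
      chain-meetingA-avoidsB γ-chain (x , x∈γ , x∈A) z∈γ z∈B =
        [ proj₁ (unrelated _ _ x∈A z∈B) , proj₂ (unrelated _ _ x∈A z∈B) ] (γ-chain _ _ x∈γ z∈γ)

      -- γ ∩ γ' misses only one element of γ, hence contains an element of γ of height i or i + 1,
      -- which lies in A because γ meets A.
      adjacent-meetsA : ∀ {γ γ'} → Adjacent r γ γ' → MeetsA γ → MeetsA γ'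
      adjacent-meetsA {γ} {γ'} (γ-maximal , _ , ∣γ∩γ'∣≡r) γ-meets
        with depth-in-layer i (proj₁ γ-maximal) (maximalChain-size γ-maximal) (p∩q⊆p γ γ') ∣γ∩γ'∣≡r i<r
      ... | z , z∈γ∩γ' , depth with x∈p∩q⁻ γ γ' z∈γ∩γ'
      ... | z∈γ , z∈γ' = z , z∈γ' ,
        [ id , ⊥-elim ∘ chain-meetingA-avoidsB (proj₁ γ-maximal) γ-meets z∈γ ]
          (cover z (maximalChain-layer γ-maximal z∈γ depth))

      connected-meetsA : ∀ {γ γ'} → Star (Adjacent r) γ γ' → MeetsA γ → MeetsA γ'
      connected-meetsA = fold (λ γ γ' → MeetsA γ → MeetsA γ') (λ adj k → k ∘ adjacent-meetsA adj) id

    layer-connected : IsStronglyConnected r → ∀ {i} → suc i ≤ r → Connected (Layer i)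
    layer-connected strongly i<r (A , B , cover , _ , _ , _ , (a , a∈A) , (b , b∈B) , unrelated) =
      chain-meetingA-avoidsB i<r cover unrelated (proj₁ γb-maximal) γb-meetsA (⊆-extend ⁅ b ⁆ (x∈⁅x⁆ b)) b∈B
      where
      γa-maximal : IsMaximalChain (extend ⁅ a ⁆)
      γa-maximal = extend-maximal (⁅⁆-chain a)
      γb-maximal : IsMaximalChain (extend ⁅ b ⁆)
      γb-maximal = extend-maximal (⁅⁆-chain b)
      γb-meetsA : MeetsA i<r cover unrelated (extend ⁅ b ⁆)
      γb-meetsA = connected-meetsA i<r cover unrelated (strongly _ _ γa-maximal γb-maximal)
        (a , ⊆-extend ⁅ a ⁆ (x∈⁅x⁆ a) , a∈A)

lemma3p1 : (n : ℕ) (_≼_ : Rel (Fin n) 0ℓ) → IsDecPartialOrder _≡_ _≼_ →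
    (r : ℕ) → FinPoset.IsRank _≼_ r →
    FinPoset.IsPure _≼_ → FinPoset.IsStronglyConnected _≼_ r →
    FinPoset.IsAntichain _≼_
      ⊎ (∀ i → suc i ≤ r → FinPoset.Connected _≼_ (FinPoset.Layer _≼_ i))
lemma3p1 n _≼_ isDecPartialOrder r rank pure strongly =
  inj₂ λ i → DecPoset.Pure.layer-connected isDecPartialOrder rank pure strongly
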